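{- Let $n \ge 3$ and $0 \le k \le n-3$ be integers, and let $P_{\min_{n,k}} = \{p_1,\dots,p_n\}$ be the sequence with $p_1 = 1$; $p_i = F(i-1)$ for $2 \le i \le k+2$; $p_{k+3} = F(k+2) = w_{F(k+2),0}$; and $p_i = w_{F(k+2),\, i-k-3}$ for $k+4 \le i \le n$ (the minimizing $k$-ordered sequence of the elongated binary tree in class $M_{n,k}$). Let $T$ be the elongated binary tree of size $n$ that is the Huffman tree of $P_{\min_{n,k}}$. Then $$E(T, P_{\min_{n,k}}) = F(n+3) + F(n-k+1) - (n-k+3).$$
   Context: $F(i)$ denotes the $i$-th Fibonacci number: $F(0)=0$, $F(1)=1$, $F(i)=F(i-1)+F(i-2)$ for $i>1$. Let $\varphi=(1+\sqrt5)/2$. The (generalized) Wythoff array $(w_{i,j})_{i\ge0,j\ge0}$ is defined by $w_{i,0}=i$, $w_{i,1}=\lfloor (i+1)\varphi\rfloor$, and $w_{i,j}=w_{i,j-1}+w_{i,j-2}$ for $j\ge2$. A (strictly) binary tree is an ordered rooted tree in which every non-leaf node has exactly two children; its size is its number of leaves. A binary tree is elongated if among any two sibling nodes at least one is a leaf. For a binary tree $T$ with positive weights $p_1,\dots,p_n$ at its leaves, the weighted external path length is $E(T,P)=\sum_{i=1}^n l_i p_i$, where $l_i$ is the length of the path from the root to leaf $i$. Huffman algorithm on a non-decreasing sequence $P$ of positive integers repeatedly replaces the two smallest weights by their sum (re-sorting each time) until one weight remains; the merges define a Huffman tree of $P$, which minimizes $E(T,P)$ over binary trees with leaf weights $P$.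 A non-decreasing sequence $P$ of $n$ positive integers with intermediate sequences $P^{(i)}=\{p^{(i)}_1,\dots\}$ ($P^{(0)}=P$, $P^{(i)}$ the sequence after the $i$-th merge) is $k$-ordered if $p^{(i)}_2 = p^{(i)}_3$ for $i=0,\dots,k$ and $p^{(i)}_2 < p^{(i)}_3$ for $i=k+1,\dots,n-3$; $M_{n,k}$ is the set of $k$-ordered sequences of size $n$ whose Huffman tree is elongated. -}

module Defs where

open import Data.Nat using (ℕ; zero; suc; _+_; _*_; _∸_; _≤_; _≤ᵇ_; _/_)
open import Data.Bool using (if_then_else_)
open import Data.List using (List; []; _∷_; [_]; map; upTo)
open import Data.List.Relation.Unary.All using (All)
open import Data.List.Relation.Binary.Permutation.Propositional using (_↭_)
open import Data.Product using (_×_)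
open import Data.Sum using (_⊎_)
open import Relation.Binary.PropositionalEquality using (_≡_)

F : ℕ → ℕ
F zero = 0
F (suc zero) = 1
F (suc (suc i)) = F (suc i) + F i

isqrt : ℕ → ℕ
isqrt zero = 0
isqrt (suc m) with isqrt m
... | r = if (suc r * suc r) ≤ᵇ suc m then suc r else r

-- ⌊ m φ ⌋ = ⌊ (m + √(5m²)) / 2 ⌋ = (m + ⌊√(5m²)⌋) div 2
floorPhi : ℕ → ℕ
floorPhi m = (m + isqrt (5 * (m * m))) / 2

w : ℕ → ℕ → ℕ
w i zero = i
w i (suc zero) = floorPhi (suc i)
w i (suc (suc j)) = w i (suc j) + w i j

-- p_i (1-based index i) of P_min(n,k)
pAt : ℕ → ℕ → ℕ
pAt k i = if i ≤ᵇ 1 then 1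
          else if i ≤ᵇ k + 2 then F (i ∸ 1)
          else w (F (k + 2)) (i ∸ (k + 3))

Pmin : ℕ → ℕ → List ℕ
Pmin n k = map (λ j → pAt k (suc j)) (upTo n)

data Tree : Set where
  leaf : ℕ → Tree
  node : Tree → Tree → Tree

IsLeaf : Tree → Set
IsLeaf (leaf _) = Data.Unit.⊤ where import Data.Unit
IsLeaf (node _ _) = Data.Empty.⊥ where import Data.Empty

Elongated : Tree → Set
Elongated (leaf _) = Data.Unit.⊤ where import Data.Unit
Elongated (node l r) = (IsLeaf l ⊎ IsLeaf r) × Elongated l × Elongated r

weight : Tree → ℕ
weight (leaf p) = p
weight (node l r) = weight l + weight r

Ed : ℕ → Tree → ℕ
Ed d (leaf p) = d * p
Ed d (node l r) = Ed (suc d) l + Ed (suc d) r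

E : Tree → ℕ
E = Ed 0

-- Runs of Huffman's algorithm on a forest (multiset of trees, up to
-- permutation): repeatedly merge two trees of smallest weights (any
-- tie-breaking allowed) until a single tree remains.
data HuffmanRun : List Tree → Tree → Set where
  done : ∀ t → HuffmanRun [ t ] t
  step : ∀ {F' t₁ t₂ R t} → F' ↭ (t₁ ∷ t₂ ∷ R) →
         weight t₁ ≤ weight t₂ →
         All (λ u → weight t₂ ≤ weight u) R →
         HuffmanRun (node t₁ t₂ ∷ R) t →
         HuffmanRun F' t

IsHuffmanTree : Tree → List ℕ → Set
IsHuffmanTree T P = HuffmanRun (map leaf P) T

-- The weights p₁ ≤ p₂ ≤ … of P_min(n,k) are sorted and every partial sum
-- p₁ + … + p_i is at most p_(i+2), so each run of Huffman's algorithm merges the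
-- tree built so far with the next leaf: T is a caterpillar and E(T) is the sum
-- of the partial sums p₁ + … + p_i, 2 ≤ i ≤ n.  With c = k + 2 one has
-- p_(j+2) = F(j+1) + F(j+1 ∸ c); for j ≥ c this is the Wythoff identity
-- w_(F c, d) = F(d + c) + F(d), whose only non-linear input is
-- ⌊(F c + 1) φ⌋ = F(c+1) + 1, a consequence of Cassini's identity.  The partial
-- sums and their sum then telescope into Fibonacci numbers.
module Submission where

open import Defs
open import Function using (_∘_)
open import Data.Bool using (true; false; T)
open import Data.Unit using (tt)
open import Data.Product using (_×_; _,_; proj₁; proj₂)
open import Data.Sum using (inj₁; inj₂)
open import Data.List using (List; []; _∷_; map; applyUpTo)
open import Data.List.Properties using (map-∘; map-id; map-applyUpTo)
open import Data.List.Membership.Propositional using (_∈_)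
open import Data.List.Relation.Unary.Any using (here; there)
open import Data.List.Relation.Unary.All as All using (All)
import Data.List.Relation.Unary.All.Properties as All
open import Data.List.Relation.Binary.Permutation.Propositional
  using (_↭_; prep; swap; ↭-refl; ↭-sym; ↭-trans; ↭-reflexive)
open import Data.List.Relation.Binary.Permutation.Propositional.Properties
  using (∈-resp-↭; drop-∷; map⁺; ↭-length)
open import Data.Nat using (ℕ; zero; suc; _+_; _*_; _∸_; _⊓_; _≤_; _<_; _≤ᵇ_; _/_; z≤n; s≤s; NonZero)
open import Data.Nat.Properties
open import Data.Nat.DivMod using (m*n/n≡m; /-monoˡ-≤; m<n*o⇒m/o<n)
open import Data.Nat.ListAction using (sum)
open import Data.Nat.ListAction.Properties using (sum-↭)
open import Data.Nat.Tactic.RingSolver using (solve; solve-∀)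
open import Algebra.Properties.CommutativeSemigroup +-commutativeSemigroup
  using (interchange; xy∙z≈xz∙y)
open import Relation.Binary.PropositionalEquality
  using (_≡_; refl; sym; trans; cong; cong₂; subst; module ≡-Reasoning)

Ed-suc : ∀ d t → Ed (suc d) t ≡ Ed d t + weight t
Ed-suc d (leaf p)   = +-comm p (d * p)
Ed-suc d (node l r) =
  trans (cong₂ _+_ (Ed-suc (suc d) l) (Ed-suc (suc d) r))
        (interchange (Ed (suc d) l) (weight l) (Ed (suc d) r) (weight r))

E-node : ∀ l r → E (node l r) ≡ E l + E r + weight (node l r)
E-node l r =
  trans (cong₂ _+_ (Ed-suc 0 l) (Ed-suc 0 r)) (interchange (E l) (weight l) (E r) (weight r))

sumE : List Tree → ℕ
sumE ts = sum (map E ts)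

sumE-merge : ∀ t₁ t₂ ts → sumE (node t₁ t₂ ∷ ts) ≡ sumE (t₁ ∷ t₂ ∷ ts) + weight (node t₁ t₂)
sumE-merge t₁ t₂ ts =
  trans (cong (_+ sumE ts) (E-node t₁ t₂))
        (rearrange (E t₁) (E t₂) (weight t₁ + weight t₂) (sumE ts))
  where
  rearrange : ∀ a b w s → a + b + w + s ≡ a + (b + s) + w
  rearrange = solve-∀

sumE-map-leaf : ∀ xs → sumE (map leaf xs) ≡ 0
sumE-map-leaf []       = refl
sumE-map-leaf (x ∷ xs) = sumE-map-leaf xs

map-weight-leaf : ∀ xs → map weight (map leaf xs) ≡ xs
map-weight-leaf xs = trans (sym (map-∘ xs)) (map-id xs)

least-≤-∈ : ∀ {a b : ℕ} {xs} → b ∈ a ∷ xs → All (a ≤_) xs → a ≤ b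
least-≤-∈ (here refl) _    = ≤-refl
least-≤-∈ (there b∈xs) a≤xs = All.lookup a≤xs b∈xs

↭-least-unique : ∀ {x y : ℕ} {xs ys} → x ∷ xs ↭ y ∷ ys →
                 All (x ≤_) xs → All (y ≤_) ys → x ≡ y
↭-least-unique p x≤xs y≤ys =
  ≤-antisym (least-≤-∈ (∈-resp-↭ (↭-sym p) (here refl)) x≤xs)
            (least-≤-∈ (∈-resp-↭ p (here refl)) y≤ys)

↭-two-least-sorted : ∀ {a b c d : ℕ} {xs ys} → a ∷ b ∷ xs ↭ c ∷ d ∷ ys →
                     a ≤ b → All (b ≤_) xs → c ≤ d → All (d ≤_) ys →
                     a ≡ c × b ≡ d × xs ↭ ys
↭-two-least-sorted p a≤b b≤xs c≤d d≤ys
  with ↭-least-unique p (a≤b All.∷ All.map (≤-trans a≤b) b≤xs) (c≤d All.∷ All.map (≤-trans c≤d) d≤ys)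
... | refl with ↭-least-unique (drop-∷ p) b≤xs d≤ys
...   | refl = refl , refl , drop-∷ (drop-∷ p)

↭-two-least : ∀ {a b c d : ℕ} {xs ys} → a ∷ b ∷ xs ↭ c ∷ d ∷ ys →
              All (a ≤_) xs → All (b ≤_) xs → c ≤ d → All (d ≤_) ys →
              a + b ≡ c + d × xs ↭ ys
↭-two-least {a} {b} p a≤xs b≤xs c≤d d≤ys with ≤-total a b
... | inj₁ a≤b with ↭-two-least-sorted p a≤b b≤xs c≤d d≤ys
...   | refl , refl , xs↭ys = refl , xs↭ys
↭-two-least {a} {b} p a≤xs b≤xs c≤d d≤ys | inj₂ b≤a
  with ↭-two-least-sorted (↭-trans (swap b a ↭-refl) p) b≤a a≤xs c≤d d≤ys
... | refl , refl , xs↭ys = +-comm a b , xs↭ys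

-- prefixSum a q j is the weight of a tree of weight a after absorbing the
-- leaves q 0, …, q (j ∸ 1); chainCost a q m is the total weight of the m
-- internal nodes created by absorbing q 0, …, q (m ∸ 1).
prefixSum : ℕ → (ℕ → ℕ) → ℕ → ℕ
prefixSum a q zero    = a
prefixSum a q (suc j) = prefixSum (a + q 0) (q ∘ suc) j

chainCost : ℕ → (ℕ → ℕ) → ℕ → ℕ
chainCost a q zero    = 0
chainCost a q (suc m) = a + q 0 + chainCost (a + q 0) (q ∘ suc) m

All-≤-applyUpTo : ∀ {x} q m → (∀ j → q j ≤ q (suc j)) → x ≤ q 0 → All (x ≤_) (applyUpTo q m)
All-≤-applyUpTo q zero    mono x≤q₀ = All.[]
All-≤-applyUpTo q (suc m) mono x≤q₀ =
  x≤q₀ All.∷ All-≤-applyUpTo (q ∘ suc) m (mono ∘ suc) (≤-trans x≤q₀ (mono 0))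

huffman-chain : ∀ {ts t} → HuffmanRun ts t → ∀ a q m →
                (∀ j → q j ≤ q (suc j)) → (∀ j → prefixSum a q j ≤ q (suc j)) →
                map weight ts ↭ a ∷ applyUpTo q m → E t ≡ sumE ts + chainCost a q m
huffman-chain (done t) a q zero _ _ _ = sym (trans (+-identityʳ _) (+-identityʳ _))
huffman-chain (done t) a q (suc m) _ _ p with ↭-length p
... | ()
huffman-chain (step ts↭ _ _ _) a q zero _ _ p
  with ↭-length (↭-trans (↭-sym (map⁺ weight ts↭)) p)
... | ()
huffman-chain {ts} {t} (step {t₁ = t₁} {t₂} {R} ts↭ t₁≤t₂ t₂≤R run) a q (suc m) mono spine p =
  begin
    E t
      ≡⟨ huffman-chain run (a + q 0) (q ∘ suc) m (mono ∘ suc) (spine ∘ suc) merged↭ ⟩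
    sumE (node t₁ t₂ ∷ R) + chainCost (a + q 0) (q ∘ suc) m
      ≡⟨ cong (_+ chainCost (a + q 0) (q ∘ suc) m) (sumE-merge t₁ t₂ R) ⟩
    sumE (t₁ ∷ t₂ ∷ R) + weight (node t₁ t₂) + chainCost (a + q 0) (q ∘ suc) m
      ≡⟨ cong₂ (λ s w → s + w + chainCost (a + q 0) (q ∘ suc) m)
               (sym (sum-↭ (map⁺ E ts↭))) (sym (proj₁ merged)) ⟩
    sumE ts + (a + q 0) + chainCost (a + q 0) (q ∘ suc) m
      ≡⟨ +-assoc (sumE ts) (a + q 0) _ ⟩
    sumE ts + chainCost a q (suc m)
  ∎
  where
  open ≡-Reasoning
  merged : a + q 0 ≡ weight t₁ + weight t₂ × applyUpTo (q ∘ suc) m ↭ map weight R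
  merged = ↭-two-least (↭-trans (↭-sym p) (map⁺ weight ts↭))
                       (All-≤-applyUpTo (q ∘ suc) m (mono ∘ suc) (spine 0))
                       (All-≤-applyUpTo (q ∘ suc) m (mono ∘ suc) (mono 0))
                       t₁≤t₂ (All.map⁺ t₂≤R)
  merged↭ : map weight (node t₁ t₂ ∷ R) ↭ a + q 0 ∷ applyUpTo (q ∘ suc) m
  merged↭ = subst (λ w → w ∷ map weight R ↭ a + q 0 ∷ applyUpTo (q ∘ suc) m)
                  (proj₁ merged) (prep (a + q 0) (↭-sym (proj₂ merged)))

prefixSum-telescope : ∀ {x} a q (A : ℕ → ℕ) → a + x ≡ A 0 → (∀ j → A (suc j) ≡ A j + q j) →
                      ∀ j → prefixSum a q j + x ≡ A j
prefixSum-telescope a q A base _ zero = base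
prefixSum-telescope {x} a q A base A-step (suc j) =
  prefixSum-telescope (a + q 0) (q ∘ suc) (A ∘ suc) base′ (A-step ∘ suc) j
  where
  base′ : a + q 0 + x ≡ A 1
  base′ = trans (xy∙z≈xz∙y a (q 0) x) (trans (cong (_+ q 0) base) (sym (A-step 0)))

chainCost-telescope : ∀ {x} a q (B : ℕ → ℕ) →
                      (∀ j → B (suc j) ≡ B j + (prefixSum a q (suc j) + x)) →
                      ∀ m → chainCost a q m + m * x + B 0 ≡ B m
chainCost-telescope a q B _ zero = refl
chainCost-telescope {x} a q B B-step (suc m) = begin
    a + q 0 + C + (x + m * x) + B 0   ≡⟨ rearrange (a + q 0) C (m * x) (B 0) ⟩
    C + m * x + (B 0 + (a + q 0 + x)) ≡⟨ cong (C + m * x +_) (B-step 0) ⟨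
    C + m * x + B 1                   ≡⟨ chainCost-telescope (a + q 0) (q ∘ suc) (B ∘ suc) (B-step ∘ suc) m ⟩
    B (suc m)                         ∎
  where
  open ≡-Reasoning
  C : ℕ
  C = chainCost (a + q 0) (q ∘ suc) m
  rearrange : ∀ s c y b → s + c + (x + y) + b ≡ c + y + (b + (s + x))
  rearrange s c y b = solve (s ∷ c ∷ x ∷ y ∷ b ∷ [])

F-≤-suc : ∀ e → F e ≤ F (suc e)
F-≤-suc zero    = z≤n
F-≤-suc (suc e) = m≤m+n _ _

F-mono : ∀ {i} j → i ≤ j → F i ≤ F j
F-mono zero    z≤n   = ≤-refl
F-mono (suc j) i≤1+j with m≤n⇒m<n∨m≡n i≤1+j
... | inj₁ i<1+j = ≤-trans (F-mono j (≤-pred i<1+j)) (F-≤-suc j)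
... | inj₂ refl  = ≤-refl

FibLike : (ℕ → ℕ) → Set
FibLike g = ∀ j → g (2 + j) ≡ g (1 + j) + g j

fibLike-unique : ∀ g h → FibLike g → FibLike h → g 0 ≡ h 0 → g 1 ≡ h 1 → ∀ j → g j ≡ h j
fibLike-unique g h fg fh e₀ e₁ zero    = e₀
fibLike-unique g h fg fh e₀ e₁ (suc j) =
  fibLike-unique (g ∘ suc) (h ∘ suc) (fg ∘ suc) (fh ∘ suc) e₁
                 (trans (fg 0) (trans (cong₂ _+_ e₁ e₀) (sym (fh 0)))) j

-- |u² − uv − v²| ≤ 1, the content of Cassini's identity for u = F (e+1), v = F e.
CassiniBounds : ℕ → ℕ → Set
CassiniBounds u v = u * u ≤ u * v + v * v + 1 × u * v + v * v ≤ u * u + 1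

cassiniBounds-step : ∀ {u v} → CassiniBounds u v → CassiniBounds (u + v) u
cassiniBounds-step {u} {v} (lo , hi) = up , down
  where
  open ≤-Reasoning
  up : (u + v) * (u + v) ≤ (u + v) * u + u * u + 1
  up = begin
    (u + v) * (u + v)               ≡⟨ solve (u ∷ v ∷ []) ⟩
    u * u + u * v + (u * v + v * v) ≤⟨ +-monoʳ-≤ (u * u + u * v) hi ⟩
    u * u + u * v + (u * u + 1)     ≡⟨ solve (u ∷ v ∷ []) ⟩
    (u + v) * u + u * u + 1         ∎
  down : (u + v) * u + u * u ≤ (u + v) * (u + v) + 1
  down = begin
    (u + v) * u + u * u                 ≡⟨ solve (u ∷ v ∷ []) ⟩
    u * u + u * v + u * u               ≤⟨ +-monoʳ-≤ (u * u + u * v) lo ⟩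
    u * u + u * v + (u * v + v * v + 1) ≡⟨ solve (u ∷ v ∷ []) ⟩
    (u + v) * (u + v) + 1               ∎

cassini : ∀ e → CassiniBounds (F (suc e)) (F e)
cassini zero    = ≤-refl , z≤n
cassini (suc e) = cassiniBounds-step {F (suc e)} {F e} (cassini e)

isqrt-spec : ∀ m → isqrt m * isqrt m ≤ m × m < suc (isqrt m) * suc (isqrt m)
isqrt-spec zero = z≤n , s≤s z≤n
isqrt-spec (suc m) with isqrt m | isqrt-spec m
... | r | r²≤m , m<[1+r]² with suc r * suc r ≤ᵇ suc m in eq
...   | true  = ≤ᵇ⇒≤ _ _ (subst T (sym eq) tt)
              , ≤-<-trans m<[1+r]² (*-mono-< (n<1+n (suc r)) (n<1+n (suc r)))
...   | false = ≤-trans r²≤m (n≤1+n m) , ≰⇒> (λ le → subst T eq (≤⇒≤ᵇ le))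

≤-isqrt : ∀ {r m} → r * r ≤ m → r ≤ isqrt m
≤-isqrt {r} {m} r²≤m =
  ≮⇒≥ (λ i<r → <⇒≱ (proj₂ (isqrt-spec m)) (≤-trans (*-mono-≤ i<r i<r) r²≤m))

isqrt-< : ∀ {r m} → m < r * r → isqrt m < r
isqrt-< {r} {m} m<r² =
  ≰⇒> (λ r≤i → <⇒≱ m<r² (≤-trans (*-mono-≤ r≤i r≤i) (proj₁ (isqrt-spec m))))

/-between : ∀ {m n q} .{{_ : NonZero n}} → q * n ≤ m → m < suc q * n → m / n ≡ q
/-between {m} {n} {q} lo hi =
  ≤-antisym (≤-pred (m<n*o⇒m/o<n hi)) (subst (_≤ m / n) (m*n/n≡m q n) (/-monoˡ-≤ n lo))

-- With x = u + v + 1 and L = 3u + v, the bounds pin isqrt (5x²) to L + 1 or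
-- L + 2, and both give the same floor of (x + isqrt (5x²)) / 2.
floorPhi-suc : ∀ {u v} → CassiniBounds u v → v ≤ u → 1 ≤ u →
               floorPhi (suc (u + v)) ≡ u + v + u + 1
floorPhi-suc {u} {v} (lo , hi) v≤u 1≤u = /-between lower upper
  where
  open ≤-Reasoning
  L M r : ℕ
  L = u + u + u + v
  M = 5 * (suc (u + v) * suc (u + v))
  r = isqrt M

  r-lower : suc L ≤ r
  r-lower = ≤-isqrt {suc L} {M} (+-cancelʳ-≤ (4 * (u * u)) _ _ (begin
    suc L * suc L + 4 * (u * u)
      ≤⟨ +-monoʳ-≤ (suc L * suc L) (*-monoʳ-≤ 4 lo) ⟩
    suc L * suc L + 4 * (u * v + v * v + 1)
      ≤⟨ m≤m+n _ (4 * u + 8 * v) ⟩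
    suc (u + u + u + v) * suc (u + u + u + v) + 4 * (u * v + v * v + 1) + (4 * u + 8 * v)
      ≡⟨ solve (u ∷ v ∷ []) ⟩
    5 * (suc (u + v) * suc (u + v)) + 4 * (u * u) ∎))

  1+4v≤8u : 1 + 4 * v ≤ 4 * u + 4 * u
  1+4v≤8u = ≤-trans (+-mono-≤ 1≤u (*-monoʳ-≤ 4 v≤u)) (+-monoˡ-≤ (4 * u) (m≤n*m u 4))

  r-upper : r < 3 + L
  r-upper = isqrt-< {3 + L} {M} (+-cancelʳ-≤ (4 * (u * v + v * v) + 4 * v) _ _ (begin
    suc (5 * (suc (u + v) * suc (u + v))) + (4 * (u * v + v * v) + 4 * v)
      ≤⟨ +-monoʳ-≤ (suc (5 * (suc (u + v) * suc (u + v)))) (+-monoˡ-≤ (4 * v) (*-monoʳ-≤ 4 hi)) ⟩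
    suc (5 * (suc (u + v) * suc (u + v))) + (4 * (u * u + 1) + 4 * v)
      ≡⟨ solve (u ∷ v ∷ []) ⟩
    5 * (suc (u + v) * suc (u + v)) + 4 * (u * u) + 4 + (1 + 4 * v)
      ≤⟨ +-monoʳ-≤ (5 * (suc (u + v) * suc (u + v)) + 4 * (u * u) + 4) 1+4v≤8u ⟩
    5 * (suc (u + v) * suc (u + v)) + 4 * (u * u) + 4 + (4 * u + 4 * u)
      ≡⟨ solve (u ∷ v ∷ []) ⟩
    (3 + (u + u + u + v)) * (3 + (u + u + u + v)) + (4 * (u * v + v * v) + 4 * v) ∎))

  lower : (u + v + u + 1) * 2 ≤ suc (u + v) + r
  lower = begin
    (u + v + u + 1) * 2               ≡⟨ solve (u ∷ v ∷ []) ⟩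
    suc (u + v) + suc (u + u + u + v) ≤⟨ +-monoʳ-≤ (suc (u + v)) r-lower ⟩
    suc (u + v) + r                   ∎

  upper : suc (u + v) + r < suc (u + v + u + 1) * 2
  upper = begin-strict
    suc (u + v) + r                     <⟨ +-monoʳ-< (suc (u + v)) r-upper ⟩
    suc (u + v) + (3 + (u + u + u + v)) ≡⟨ solve (u ∷ v ∷ []) ⟩
    suc (u + v + u + 1) * 2             ∎

floorPhi-F : ∀ e → floorPhi (suc (F (e + 2))) ≡ F (suc (e + 2)) + 1
floorPhi-F e rewrite +-comm e 2 =
  floorPhi-suc {F (suc e)} {F e} (cassini e) (F-≤-suc e) (F-mono (suc e) (s≤s z≤n))

w-F : ∀ e d → w (F (e + 2)) d ≡ F (d + (e + 2)) + F d
w-F e = fibLike-unique (w (F (e + 2))) (λ d → F (d + (e + 2)) + F d)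
                       (λ _ → refl)
                       (λ d → interchange (F (suc d + (e + 2))) (F (d + (e + 2))) (F (suc d)) (F d))
                       (sym (+-identityʳ _)) (floorPhi-F e)

pAt-2+ : ∀ k j → pAt k (2 + j) ≡ F (suc j) + F (suc j ∸ (k + 2))
pAt-2+ k j with 2 + j ≤ᵇ k + 2 in eq
... | true =
  sym (trans (cong (λ i → F (suc j) + F i) (m≤n⇒m∸n≡0 1+j≤k+2)) (+-identityʳ (F (suc j))))
  where
  1+j≤k+2 : suc j ≤ k + 2
  1+j≤k+2 = ≤-trans (n≤1+n (suc j)) (≤ᵇ⇒≤ (2 + j) (k + 2) (subst T (sym eq) tt))
... | false rewrite +-suc k 2 =
  trans (w-F k (suc j ∸ (k + 2))) (cong (λ i → F i + F (suc j ∸ (k + 2))) (m∸n+n≡m k+2≤1+j))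
  where
  k+2≤1+j : k + 2 ≤ suc j
  k+2≤1+j = ≤-pred (≰⇒> (λ le → subst T eq (≤⇒≤ᵇ le)))

F-delay-step : ∀ c j → F (2 + (j ∸ c)) + F (suc j ∸ c) ≡ F (2 + (suc j ∸ c))
F-delay-step c j with <-≤-connex j c
... | inj₁ j<c rewrite m≤n⇒m∸n≡0 (<⇒≤ j<c) | m≤n⇒m∸n≡0 j<c = refl
... | inj₂ c≤j rewrite +-∸-assoc 1 c≤j = refl

F-delay-sum-step : ∀ c j → F (4 + (j ∸ c)) + (j ⊓ c) + F (2 + (suc j ∸ c))
                         ≡ F (4 + (suc j ∸ c)) + (suc j ⊓ c)
F-delay-sum-step c j with <-≤-connex j c
... | inj₁ j<c rewrite m≤n⇒m∸n≡0 (<⇒≤ j<c) | m≤n⇒m∸n≡0 j<c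
                     | m≤n⇒m⊓n≡m (<⇒≤ j<c) | m≤n⇒m⊓n≡m j<c =
  trans (+-assoc (F 4) j 1) (cong (F 4 +_) (+-comm j 1))
... | inj₂ c≤j rewrite +-∸-assoc 1 c≤j | m≥n⇒m⊓n≡n c≤j | m≥n⇒m⊓n≡n (m≤n⇒m≤1+n c≤j) =
  xy∙z≈xz∙y (F (4 + (j ∸ c))) c (F (3 + (j ∸ c)))

F-delay-bound : ∀ c j → F (2 + (j ∸ c)) ≤ F (2 + j ∸ c) + 1
F-delay-bound c j with <-≤-connex j c
... | inj₁ j<c rewrite m≤n⇒m∸n≡0 (<⇒≤ j<c) = m≤n+m 1 _
... | inj₂ c≤j rewrite +-∸-assoc 2 c≤j = m≤m+n _ 1

Pmin-weights : ∀ m k →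
               map weight (map leaf (Pmin (suc m) k)) ≡ 1 ∷ applyUpTo (λ j → pAt k (2 + j)) m
Pmin-weights m k =
  trans (map-weight-leaf _) (cong (1 ∷_) (map-applyUpTo suc (λ j → pAt k (suc j)) m))

module _ (k : ℕ) where

  private
    c : ℕ
    c = k + 2

  p₂₊ : ℕ → ℕ
  p₂₊ j = pAt k (2 + j)

  p₂₊-mono : ∀ j → p₂₊ j ≤ p₂₊ (suc j)
  p₂₊-mono j rewrite pAt-2+ k j | pAt-2+ k (suc j) =
    +-mono-≤ (F-≤-suc (suc j)) (F-mono (suc (suc j) ∸ c) (∸-monoˡ-≤ c (n≤1+n (suc j))))

  p₂₊-prefixSum : ∀ j → prefixSum 1 p₂₊ j + 1 ≡ F (2 + j) + F (2 + (j ∸ c))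
  p₂₊-prefixSum = prefixSum-telescope {x = 1} 1 p₂₊ (λ j → F (2 + j) + F (2 + (j ∸ c)))
                    (sym (cong (λ d → F 2 + F (2 + d)) (0∸n≡0 c))) A-step
    where
    open ≡-Reasoning
    A-step : ∀ j → F (3 + j) + F (2 + (suc j ∸ c)) ≡ F (2 + j) + F (2 + (j ∸ c)) + p₂₊ j
    A-step j = begin
      F (3 + j) + F (2 + (suc j ∸ c))
        ≡⟨ cong (F (3 + j) +_) (F-delay-step c j) ⟨
      F (2 + j) + F (1 + j) + (F (2 + (j ∸ c)) + F (suc j ∸ c))
        ≡⟨ interchange (F (2 + j)) (F (1 + j)) (F (2 + (j ∸ c))) (F (suc j ∸ c)) ⟩
      F (2 + j) + F (2 + (j ∸ c)) + (F (1 + j) + F (suc j ∸ c))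
        ≡⟨ cong (F (2 + j) + F (2 + (j ∸ c)) +_) (pAt-2+ k j) ⟨
      F (2 + j) + F (2 + (j ∸ c)) + p₂₊ j ∎

  p₂₊-spine : ∀ j → prefixSum 1 p₂₊ j ≤ p₂₊ (suc j)
  p₂₊-spine j = +-cancelʳ-≤ 1 _ _ (begin
    prefixSum 1 p₂₊ j + 1              ≡⟨ p₂₊-prefixSum j ⟩
    F (2 + j) + F (2 + (j ∸ c))        ≤⟨ +-monoʳ-≤ (F (2 + j)) (F-delay-bound c j) ⟩
    F (2 + j) + (F (2 + j ∸ c) + 1)    ≡⟨ +-assoc (F (2 + j)) _ 1 ⟨
    F (2 + j) + F (2 + j ∸ c) + 1      ≡⟨ cong (_+ 1) (pAt-2+ k (suc j)) ⟨
    p₂₊ (suc j) + 1                    ∎)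
    where open ≤-Reasoning

  Pmin-E : ∀ {m T} → IsHuffmanTree T (Pmin (suc m) k) → E T ≡ chainCost 1 p₂₊ m
  Pmin-E {m} huffman =
    trans (huffman-chain huffman 1 p₂₊ m p₂₊-mono p₂₊-spine (↭-reflexive (Pmin-weights m k)))
          (cong (_+ chainCost 1 p₂₊ m) (sumE-map-leaf (Pmin (suc m) k)))

  Pmin-cost : ∀ t → chainCost 1 p₂₊ (c + t) + (6 + t) ≡ F (4 + (c + t)) + F (4 + t)
  Pmin-cost t = +-cancelʳ-≡ c _ _ (begin
      chainCost 1 p₂₊ (c + t) + (6 + t) + c
        ≡⟨ rearrange (chainCost 1 p₂₊ (c + t)) c t ⟩
      chainCost 1 p₂₊ (c + t) + (c + t) * 1 + 6
        ≡⟨ cong (λ d → chainCost 1 p₂₊ (c + t) + (c + t) * 1 + (F 4 + F (4 + d) + 0)) (0∸n≡0 c) ⟨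
      chainCost 1 p₂₊ (c + t) + (c + t) * 1 + B 0
        ≡⟨ chainCost-telescope 1 p₂₊ B B-step (c + t) ⟩
      F (4 + (c + t)) + F (4 + (c + t ∸ c)) + ((c + t) ⊓ c)
        ≡⟨ cong₂ (λ d e → F (4 + (c + t)) + F (4 + d) + e)
                 (m+n∸m≡n c t) (m≥n⇒m⊓n≡n (m≤m+n c t)) ⟩
      F (4 + (c + t)) + F (4 + t) + c ∎)
    where
    open ≡-Reasoning
    -- Up to a constant, B j sums the spine weights F (2 + i) + F (2 + (i ∸ c)),
    -- 1 ≤ i ≤ j; the summand j ⊓ c collects the terms F (2 + (i ∸ c)) = F 2 = 1, i ≤ c.
    B : ℕ → ℕ
    B j = F (4 + j) + F (4 + (j ∸ c)) + (j ⊓ c)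
    rearrange : ∀ s c t → s + (6 + t) + c ≡ s + (c + t) * 1 + 6
    rearrange = solve-∀
    regroup : ∀ a b x y z → a + b + (x + y + z) ≡ a + x + y + (b + z)
    regroup = solve-∀
    B-step : ∀ j → B (suc j) ≡ B j + (prefixSum 1 p₂₊ (suc j) + 1)
    B-step j = begin
      F (5 + j) + F (4 + (suc j ∸ c)) + (suc j ⊓ c)
        ≡⟨ +-assoc (F (5 + j)) _ _ ⟩
      F (5 + j) + (F (4 + (suc j ∸ c)) + (suc j ⊓ c))
        ≡⟨ cong (F (5 + j) +_) (F-delay-sum-step c j) ⟨
      F (4 + j) + F (3 + j) + (F (4 + (j ∸ c)) + (j ⊓ c) + F (2 + (suc j ∸ c)))
        ≡⟨ regroup (F (4 + j)) (F (3 + j)) (F (4 + (j ∸ c))) (j ⊓ c) (F (2 + (suc j ∸ c))) ⟩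
      B j + (F (3 + j) + F (2 + (suc j ∸ c)))
        ≡⟨ cong (B j +_) (p₂₊-prefixSum (suc j)) ⟨
      B j + (prefixSum 1 p₂₊ (suc j) + 1) ∎

1+[k+2+t]∸k : ∀ k t → suc (k + 2 + t) ∸ k ≡ 3 + t
1+[k+2+t]∸k k t = trans (cong (_∸ k) (regroup k t)) (m+n∸m≡n k (3 + t))
  where
  regroup : ∀ k t → suc (k + 2 + t) ≡ k + (3 + t)
  regroup = solve-∀

theorem3 : (n k : ℕ) → 3 ≤ n → k + 3 ≤ n → (T : Tree) →
    IsHuffmanTree T (Pmin n k) → Elongated T →
    E T + ((n ∸ k) + 3) ≡ F (n + 3) + F ((n ∸ k) + 1)
theorem3 zero _ () _ _ _ _
theorem3 (suc m) k _ k+3≤n T huffman _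
  with m≤n⇒∃[o]m+o≡n (≤-pred (subst (_≤ suc m) (+-suc k 2) k+3≤n))
... | t , refl = begin
    E T + (suc (k + 2 + t) ∸ k + 3)
      ≡⟨ cong₂ (λ e d → e + (d + 3)) (Pmin-E k huffman) (1+[k+2+t]∸k k t) ⟩
    chainCost 1 (p₂₊ k) (k + 2 + t) + (3 + t + 3)
      ≡⟨ cong (chainCost 1 (p₂₊ k) (k + 2 + t) +_) (+-comm (3 + t) 3) ⟩
    chainCost 1 (p₂₊ k) (k + 2 + t) + (6 + t)
      ≡⟨ Pmin-cost k t ⟩
    F (4 + (k + 2 + t)) + F (4 + t)
      ≡⟨ cong₂ (λ a b → F a + F b) (+-comm (suc (k + 2 + t)) 3)
               (trans (cong (_+ 1) (1+[k+2+t]∸k k t)) (+-comm (3 + t) 1)) ⟨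
    F (suc (k + 2 + t) + 3) + F (suc (k + 2 + t) ∸ k + 1)
  ∎
  where open ≡-Reasoning
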